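{- Let $d>6$ and let $G$ be a finite simple $d$-regular graph such that $G^2$ is not complete. Let $R$ be a C region, let $v\in R$ satisfy $\deg_2(v)=2$ and $N_2'(v)=\{u\}$, and let $G_v$ be the vertex set of the connected component of $G-u$ containing $v$. Then $R=G_v$.
   Context: $N_i(x)$ is the set of vertices at distance exactly $i$ from $x$, $N(x)=N_1(x)$, $\deg_2(x)=|N_2(x)|$; $N_2'(x)$ is the set of vertices of $N_2(x)$ adjacent to some vertex of $N_3(x)$. Let $X=\{x:\deg_2(x)<4\}$; $u\sim w$ on $X$ iff there is a sequence of vertices of $X$ from $u$ to $w$ with consecutive vertices at distance at most 2. A region is an equivalence class of $\sim$ together with all neighbors of its vertices. A C region is a region $R$ such that no vertex of $R$ has $\deg_2=1$ and some vertex $v'\in R$ satisfies $\deg_2(v')=2$ and $|N_2'(v')|=1$. -}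

module Defs where

open import Data.Nat using (ℕ; zero; suc; _+_; _<_)
open import Data.Bool using (Bool; true; false; _∧_; _∨_; not; if_then_else_; T)
open import Data.Fin using (Fin; _≟_)
open import Data.List using (List; map; allFin)
open import Data.Nat.ListAction using (sum)
open import Data.Bool.ListAction using (any)
open import Data.Product using (Σ; ∃; ∃₂; _×_; _,_)
open import Data.Sum using (_⊎_)
open import Relation.Nullary using (¬_)
open import Relation.Nullary.Decidable using (⌊_⌋)
open import Relation.Binary.PropositionalEquality using (_≡_; _≢_)

record Graph (n : ℕ) : Set where
  field
    adj     : Fin n → Fin n → Bool
    sym     : ∀ x y → adj x y ≡ adj y x
    irrefl  : ∀ x → adj x x ≡ false
open Graph public

module _ {n : ℕ} (G : Graph n) where

  count : (Fin n → Bool) → ℕ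
  count p = sum (map (λ x → if p x then 1 else 0) (allFin n))

  within : ℕ → Fin n → Fin n → Bool
  within zero x y = ⌊ x ≟ y ⌋
  within (suc k) x y = within k x y ∨ any (λ z → within k x z ∧ adj G z y) (allFin n)

  Nbhd : ℕ → Fin n → Fin n → Bool
  Nbhd zero x y = within zero x y
  Nbhd (suc k) x y = within (suc k) x y ∧ not (within k x y)

  deg : Fin n → ℕ
  deg x = count (adj G x)

  deg₂ : Fin n → ℕ
  deg₂ x = count (Nbhd 2 x)

  N₂' : Fin n → Fin n → Bool
  N₂' x y = Nbhd 2 x y ∧ any (λ z → Nbhd 3 x z ∧ adj G y z) (allFin n)

  Regular : ℕ → Set
  Regular d = ∀ x → deg x ≡ d

  SquareNotComplete : Set
  SquareNotComplete = ∃₂ λ x y → within 2 x y ≡ false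

  InX : Fin n → Set
  InX x = deg₂ x < 4

  -- Chain x y : a sequence of vertices of X from x to y, consecutive ones at distance ≤ 2
  -- (so Chain x y holds iff x, y ∈ X and x ∼ y)
  data Chain (x : Fin n) : Fin n → Set where
    start : InX x → Chain x x
    step  : ∀ {y z} → Chain x y → InX z → T (within 2 y z) → Chain x z

  Region : Fin n → Fin n → Set
  Region x₀ y = Chain x₀ y ⊎ ∃ λ z → Chain x₀ z × T (adj G z y)

  IsCRegion : (Fin n → Set) → Set
  IsCRegion R = (∀ y → R y → deg₂ y ≢ 1)
              × ∃ λ v' → R v' × deg₂ v' ≡ 2 × count (N₂' v') ≡ 1

  data CompAvoid (u v : Fin n) : Fin n → Set where
    here  : v ≢ u → CompAvoid u v v
    there : ∀ {y z} → CompAvoid u v y → T (adj G y z) → z ≢ u → CompAvoid u v z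

-- Let B be the ball of radius 2 around v and Gᵥ = B ∖ {u}.  Since deg₂ v = 2 we have
-- |B| = d + 3, and since N₂'(v) = {u}, every vertex of Gᵥ has all its neighbours in B.
-- So each vertex of Gᵥ has at least d − 3 neighbours among the d neighbours of v, and as
-- d > 6 any two vertices of Gᵥ have a common neighbour there: Gᵥ has diameter at most 2 and
-- is a connected component of G − u.  All edges leaving B start at u; there are t ≥ 1 of
-- them, and t is even by the handshake lemma, so t ≥ 2.  Counting inside B then shows that
-- a vertex of Gᵥ lies in X iff it is not adjacent to u, that deg₂ u ≥ 4, and that every
-- vertex of Gᵥ has a neighbour in Gᵥ ∩ X.  Hence the ∼-class of v is Gᵥ ∩ X, and the region
-- it spans is exactly Gᵥ.
module Submission where

open import Defs hiding (sym)
open import Data.Bool using (Bool; true; false; _∧_; _∨_; not; if_then_else_; T)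
open import Data.Bool.ListAction using (any)
open import Data.Bool.Properties using (∧-zeroʳ)
open import Data.Empty using (⊥-elim)
open import Data.Fin using (Fin; zero; suc; _≟_)
open import Data.List using (map; tabulate; allFin)
open import Data.List.Membership.Propositional.Properties using (∈-allFin)
import Data.List.Relation.Unary.Any as Any
open import Data.List.Relation.Unary.Any.Properties using (any⁺; any⁻)
open import Data.Nat using (ℕ; zero; suc; _+_; _*_; _≤_; _<_; z≤n; s≤s; s≤s⁻¹; _≤?_; >-nonZero)
open import Data.Nat.Divisibility using (_∣_; _∣0; ∣m∣n⇒∣m+n; ∣m+n∣m⇒∣n; m∣m*n; ∣⇒≤)
open import Data.Nat.ListAction using (sum)
open import Data.Nat.Properties hiding (_≟_)
open import Data.Nat.Tactic.RingSolver using (solve-∀)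
open import Algebra.Properties.Semiring.Sum +-*-semiring
  using (sum-syntax; sum-cong-≗; ∑-distrib-+; sum-replicate-zero; *-distribʳ-sum)
open import Data.Product using (∃; _×_; _,_; proj₁)
open import Data.Sum using (_⊎_; inj₁; inj₂)
open import Data.Unit using (tt)
open import Function using (_∘_)
open import Function.Bundles using (_⇔_; mk⇔; Equivalence)
open import Relation.Nullary using (¬_; yes; no)
open import Relation.Nullary.Decidable using (⌊_⌋)
open import Relation.Binary.PropositionalEquality

private variable
  n : ℕ
  a b : Bool

-- Boolean predicates and their cardinalities

∧-intro : T a → T b → T (a ∧ b)
∧-intro {true} _ tb = tb

∧-elimˡ : T (a ∧ b) → T a
∧-elimˡ {true} _ = tt

∧-elimʳ : T (a ∧ b) → T b
∧-elimʳ {true} tb = tb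

∨-introˡ : T a → T (a ∨ b)
∨-introˡ {true} _ = tt

∨-introʳ : T b → T (a ∨ b)
∨-introʳ {a = true} _ = tt
∨-introʳ {a = false} tb = tb

∨-elim : T (a ∨ b) → T a ⊎ T b
∨-elim {true} _ = inj₁ tt
∨-elim {false} tb = inj₂ tb

not-intro : ¬ T a → T (not a)
not-intro {true} ¬ta = ¬ta tt
not-intro {false} _ = tt

not-elim : T (not a) → ¬ T a
not-elim {true} ()

T-dec : ∀ b → T b ⊎ ¬ T b
T-dec true = inj₁ tt
T-dec false = inj₂ λ ()

infixl 7 _∩_ _∖_
infixl 6 _∪_
infix 4 _⊆_

_∩_ _∪_ _∖_ : (Fin n → Bool) → (Fin n → Bool) → Fin n → Bool
(p ∩ q) x = p x ∧ q x
(p ∪ q) x = p x ∨ q x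
(p ∖ q) x = p x ∧ not (q x)

⁅_⁆ : Fin n → Fin n → Bool
⁅ y ⁆ x = ⌊ x ≟ y ⌋

_⊆_ : (Fin n → Bool) → (Fin n → Bool) → Set
p ⊆ q = ∀ x → T (p x) → T (q x)

x∈⁅y⁆⇒x≡y : ∀ {x y : Fin n} → T (⁅ y ⁆ x) → x ≡ y
x∈⁅y⁆⇒x≡y {x = x} {y} _ with x ≟ y
... | yes x≡y = x≡y

x≡y⇒x∈⁅y⁆ : ∀ {x y : Fin n} → x ≡ y → T (⁅ y ⁆ x)
x≡y⇒x∈⁅y⁆ {x = x} {y} x≡y with x ≟ y
... | yes _ = tt
... | no x≢y = x≢y x≡y

ind : Bool → ℕ
ind b = if b then 1 else 0

∑-mono-≤ : ∀ {n} {f g : Fin n → ℕ} → (∀ i → f i ≤ g i) → ∑[ i < n ] f i ≤ ∑[ i < n ] g i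
∑-mono-≤ {zero} _ = z≤n
∑-mono-≤ {suc n} f≤g = +-mono-≤ (f≤g zero) (∑-mono-≤ (f≤g ∘ suc))

-- Opaque, so that Agda can recover p from ∣ p ∣ when inferring implicit arguments.
opaque
  ∣_∣ : (Fin n → Bool) → ℕ
  ∣_∣ {n} p = ∑[ x < n ] ind (p x)

  count≡∣∣ : (G : Graph n) (p : Fin n → Bool) → count G p ≡ ∣ p ∣
  count≡∣∣ G p = sum-map-tabulate (ind ∘ p) (λ x → x)
    where
    sum-map-tabulate : ∀ {n} {A : Set} (f : A → ℕ) (g : Fin n → A) →
                       sum (map f (tabulate g)) ≡ ∑[ i < n ] f (g i)
    sum-map-tabulate {zero} f g = refl
    sum-map-tabulate {suc n} f g = cong (f (g zero) +_) (sum-map-tabulate f (g ∘ suc))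

  ∣∣-as-∑ : (p : Fin n → Bool) → ∣ p ∣ ≡ ∑[ x < n ] ind (p x)
  ∣∣-as-∑ p = refl

  ∣∣-mono : ∀ {p q : Fin n → Bool} → p ⊆ q → ∣ p ∣ ≤ ∣ q ∣
  ∣∣-mono p⊆q = ∑-mono-≤ λ x → ind-mono (p⊆q x)
    where
    ind-mono : (T a → T b) → ind a ≤ ind b
    ind-mono {false} _ = z≤n
    ind-mono {true} {true} _ = ≤-refl
    ind-mono {true} {false} a⇒b = ⊥-elim (a⇒b tt)

  ∣∣-split : (p q : Fin n → Bool) → ∣ p ∣ ≡ ∣ p ∩ q ∣ + ∣ p ∖ q ∣
  ∣∣-split p q = trans (sum-cong-≗ λ x → ind-split (p x) (q x))
                       (∑-distrib-+ (ind ∘ (p ∩ q)) (ind ∘ (p ∖ q)))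
    where
    ind-split : ∀ a b → ind a ≡ ind (a ∧ b) + ind (a ∧ not b)
    ind-split false _ = refl
    ind-split true true = refl
    ind-split true false = refl

  ∣∣-∪ : (p q : Fin n → Bool) → ∣ p ∪ q ∣ ≤ ∣ p ∣ + ∣ q ∣
  ∣∣-∪ p q = ≤-trans (∑-mono-≤ λ x → ind-∨ (p x) (q x))
                     (≤-reflexive (∑-distrib-+ (ind ∘ p) (ind ∘ q)))
    where
    ind-∨ : ∀ a b → ind (a ∨ b) ≤ ind a + ind b
    ind-∨ true _ = s≤s z≤n
    ind-∨ false _ = ≤-refl

  ∣∣-empty : (p : Fin n → Bool) → (∀ x → ¬ T (p x)) → ∣ p ∣ ≡ 0
  ∣∣-empty {n} p empty = trans (sum-cong-≗ λ x → ind-false (empty x)) (sum-replicate-zero n)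
    where
    ind-false : ¬ T a → ind a ≡ 0
    ind-false {false} _ = refl
    ind-false {true} ¬t = ⊥-elim (¬t tt)

  ∣⁅x⁆∣≡1 : (x : Fin n) → ∣ ⁅ x ⁆ ∣ ≡ 1
  ∣⁅x⁆∣≡1 {suc n} zero = cong suc (∣∣-empty {n} _ λ _ ())
  ∣⁅x⁆∣≡1 {suc n} (suc x) = trans (sum-cong-≗ ⁅suc⁆) (∣⁅x⁆∣≡1 x)
    where
    ⁅suc⁆ : ∀ y → ind (⁅ suc x ⁆ (suc y)) ≡ ind (⁅ x ⁆ y)
    ⁅suc⁆ y with y ≟ x
    ... | yes _ = refl
    ... | no _ = refl

  ∣∣-nonempty : (p : Fin n → Bool) → 0 < ∣ p ∣ → ∃ λ x → T (p x)
  ∣∣-nonempty {suc n} p pos with p zero in p0≡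
  ... | true = zero , subst T (sym p0≡) tt
  ... | false with ∣∣-nonempty (p ∘ suc) pos
  ...   | x , px = suc x , px

∣∣-cong : ∀ {p q : Fin n → Bool} → p ⊆ q → q ⊆ p → ∣ p ∣ ≡ ∣ q ∣
∣∣-cong p⊆q q⊆p = ≤-antisym (∣∣-mono p⊆q) (∣∣-mono q⊆p)

∣∣-positive : (p : Fin n → Bool) {x : Fin n} → T (p x) → 0 < ∣ p ∣
∣∣-positive p {x} px = subst (_≤ ∣ p ∣) (∣⁅x⁆∣≡1 x)
  (∣∣-mono λ y y∈⁅x⁆ → subst (T ∘ p) (sym (x∈⁅y⁆⇒x≡y y∈⁅x⁆)) px)

∣∣-⊆ : {p q : Fin n → Bool} → q ⊆ p → ∣ q ∣ + ∣ p ∖ q ∣ ≡ ∣ p ∣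
∣∣-⊆ {p = p} {q} q⊆p = sym (trans (∣∣-split p q) (cong (_+ ∣ p ∖ q ∣)
  (∣∣-cong (λ _ → ∧-elimʳ) λ x qx → ∧-intro (q⊆p x qx) qx)))

∣∣-overlap : {p q r : Fin n → Bool} → p ⊆ r → q ⊆ r → ∣ r ∣ < ∣ p ∣ + ∣ q ∣ →
             ∃ λ x → T (p x) × T (q x)
∣∣-overlap {p = p} {q} {r} p⊆r q⊆r r<p+q
  with ∣∣-nonempty (p ∩ q) (+-cancelʳ-≤ (∣ r ∣) 1 (∣ p ∩ q ∣) 1+r≤p∩q+r)
  where
  open ≤-Reasoning
  p∖q≤r∖q : ∣ p ∖ q ∣ ≤ ∣ r ∖ q ∣
  p∖q≤r∖q = ∣∣-mono λ x h → ∧-intro (p⊆r x (∧-elimˡ h)) (∧-elimʳ {p x} h)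
  1+r≤p∩q+r : 1 + ∣ r ∣ ≤ ∣ p ∩ q ∣ + ∣ r ∣
  1+r≤p∩q+r = begin
    1 + ∣ r ∣                         ≤⟨ r<p+q ⟩
    ∣ p ∣ + ∣ q ∣                      ≡⟨ cong (_+ ∣ q ∣) (∣∣-split p q) ⟩
    ∣ p ∩ q ∣ + ∣ p ∖ q ∣ + ∣ q ∣        ≡⟨ +-assoc ∣ p ∩ q ∣ _ _ ⟩
    ∣ p ∩ q ∣ + (∣ p ∖ q ∣ + ∣ q ∣)      ≤⟨ +-monoʳ-≤ ∣ p ∩ q ∣ (+-monoˡ-≤ ∣ q ∣ p∖q≤r∖q) ⟩
    ∣ p ∩ q ∣ + (∣ r ∖ q ∣ + ∣ q ∣)      ≡⟨ cong (∣ p ∩ q ∣ +_) (trans (+-comm _ ∣ q ∣) (∣∣-⊆ q⊆r)) ⟩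
    ∣ p ∩ q ∣ + ∣ r ∣                  ∎
... | x , pqx = x , ∧-elimˡ pqx , ∧-elimʳ {p x} pqx

any-allFin⁺ : (p : Fin n → Bool) {x : Fin n} → T (p x) → T (any p (allFin n))
any-allFin⁺ p px = any⁺ p (Any.map (λ { refl → px }) (∈-allFin _))

any-allFin⁻ : (p : Fin n → Bool) → T (any p (allFin n)) → ∃ λ x → T (p x)
any-allFin⁻ {n} p t = Any.satisfied (any⁻ p (allFin n) t)

-- Handshake lemma

∑∑-symmetric-even : ∀ {n} (F : Fin n → Fin n → ℕ) → (∀ x y → F x y ≡ F y x) → (∀ x → F x x ≡ 0) →
                    2 ∣ ∑[ x < n ] ∑[ y < n ] F x y
∑∑-symmetric-even {zero} F _ _ = 2 ∣0
∑∑-symmetric-even {suc n} F F-sym F-diag = subst (2 ∣_) (sym peel)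
  (∣m∣n⇒∣m+n (m∣m*n r) (∑∑-symmetric-even F′ (λ x y → F-sym (suc x) (suc y)) (F-diag ∘ suc)))
  where
  open ≡-Reasoning
  F′ : Fin n → Fin n → ℕ
  F′ x y = F (suc x) (suc y)
  r rest : ℕ
  r = ∑[ y < n ] F zero (suc y)
  rest = ∑[ x < n ] ∑[ y < n ] F′ x y
  peel : ∑[ x < suc n ] ∑[ y < suc n ] F x y ≡ 2 * r + rest
  peel = begin
    F zero zero + r + ∑[ x < n ] (F (suc x) zero + ∑[ y < n ] F′ x y)
      ≡⟨ cong₂ _+_ (cong (_+ r) (F-diag zero)) (∑-distrib-+ (λ x → F (suc x) zero) (λ x → ∑[ y < n ] F′ x y)) ⟩
    r + (∑[ x < n ] F (suc x) zero + rest)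
      ≡⟨ cong (λ s → r + (s + rest)) (sum-cong-≗ λ x → F-sym (suc x) zero) ⟩
    r + (r + rest)
      ≡⟨ sym (+-assoc r r rest) ⟩
    r + r + rest
      ≡⟨ cong (λ s → r + s + rest) (sym (+-identityʳ r)) ⟩
    2 * r + rest ∎

module DegreeSum {n : ℕ} (G : Graph n) {d : ℕ} (regular : ∀ x → ∣ adj G x ∣ ≡ d) (S : Fin n → Bool) where

  adjFrom : Fin n → Fin n → Bool
  adjFrom x y = S x ∧ adj G x y

  edgesIn edgesOut : ℕ
  edgesIn = ∑[ x < n ] ∣ adjFrom x ∩ S ∣
  edgesOut = ∑[ x < n ] ∣ adjFrom x ∖ S ∣

  2∣edgesIn : 2 ∣ edgesIn
  2∣edgesIn = subst (2 ∣_) (sum-cong-≗ λ x → sym (∣∣-as-∑ (adjFrom x ∩ S)))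
    (∑∑-symmetric-even (λ x y → ind ((adjFrom x ∩ S) y)) (λ x y → cong ind (in-sym x y)) (cong ind ∘ in-irrefl))
    where
    in-sym : ∀ x y → (S x ∧ adj G x y) ∧ S y ≡ (S y ∧ adj G y x) ∧ S x
    in-sym x y with S x | S y
    ... | true | true = cong (_∧ true) (Graph.sym G x y)
    ... | true | false = ∧-zeroʳ (adj G x y)
    ... | false | true = sym (∧-zeroʳ (adj G y x))
    ... | false | false = refl
    in-irrefl : ∀ x → (S x ∧ adj G x x) ∧ S x ≡ false
    in-irrefl x with S x
    ... | true = cong (_∧ true) (Graph.irrefl G x)
    ... | false = refl

  edgesIn+edgesOut≡∣S∣*d : edgesIn + edgesOut ≡ ∣ S ∣ * d
  edgesIn+edgesOut≡∣S∣*d = begin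
    edgesIn + edgesOut                                  ≡⟨ ∑-distrib-+ (λ x → ∣ adjFrom x ∩ S ∣) (λ x → ∣ adjFrom x ∖ S ∣) ⟨
    ∑[ x < n ] (∣ adjFrom x ∩ S ∣ + ∣ adjFrom x ∖ S ∣)  ≡⟨ sum-cong-≗ (λ x → ∣∣-split (adjFrom x) S) ⟨
    ∑[ x < n ] ∣ adjFrom x ∣                            ≡⟨ sum-cong-≗ ∣adjFrom∣ ⟩
    ∑[ x < n ] (ind (S x) * d)                          ≡⟨ *-distribʳ-sum d (ind ∘ S) ⟨
    ∑[ x < n ] ind (S x) * d                            ≡⟨ cong (_* d) (∣∣-as-∑ S) ⟨
    ∣ S ∣ * d                                           ∎
    where
    open ≡-Reasoning
    ∣adjFrom∣ : ∀ x → ∣ adjFrom x ∣ ≡ ind (S x) * d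
    ∣adjFrom∣ x with S x
    ... | true = trans (regular x) (sym (+-identityʳ d))
    ... | false = ∣∣-empty _ λ _ ()

  2∣edgesOut : 2 ∣ ∣ S ∣ * d → 2 ∣ edgesOut
  2∣edgesOut 2∣S*d = ∣m+n∣m⇒∣n (subst (2 ∣_) (sym edgesIn+edgesOut≡∣S∣*d) 2∣S*d) 2∣edgesIn

2∣n*[1+n] : ∀ m → 2 ∣ m * suc m
2∣n*[1+n] zero = 2 ∣0
2∣n*[1+n] (suc m) = subst (2 ∣_) (sym (expand m)) (∣m∣n⇒∣m+n (2∣n*[1+n] m) (m∣m*n (suc m)))
  where
  expand : ∀ m → suc m * suc (suc m) ≡ m * suc m + 2 * suc m
  expand = solve-∀

2∣[d+3]*d : ∀ d → 2 ∣ (suc d + 2) * d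
2∣[d+3]*d d = subst (2 ∣_) (sym (expand d)) (∣m∣n⇒∣m+n (2∣n*[1+n] d) (m∣m*n d))
  where
  expand : ∀ d → (suc d + 2) * d ≡ d * suc d + 2 * d
  expand = solve-∀

-- Distances

module Distance {n : ℕ} (G : Graph n) where

  infix 4 _~_
  _~_ : Fin n → Fin n → Set
  x ~ y = T (adj G x y)

  ~-sym : ∀ {x y} → x ~ y → y ~ x
  ~-sym {x} {y} = subst T (Graph.sym G x y)

  ~-irrefl : ∀ {x} → ¬ x ~ x
  ~-irrefl {x} = subst T (Graph.irrefl G x)

  Dist≤ : ℕ → Fin n → Fin n → Set
  Dist≤ k x y = T (within G k x y)

  N[_] : Fin n → Fin n → Bool
  N[ x ] = within G 1 x

  dist≤0-refl : ∀ {x} → Dist≤ 0 x x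
  dist≤0-refl = x≡y⇒x∈⁅y⁆ refl

  dist≤-weaken : ∀ {k x y} → Dist≤ k x y → Dist≤ (suc k) x y
  dist≤-weaken = ∨-introˡ

  dist≤-step : ∀ {k x y z} → Dist≤ k x z → z ~ y → Dist≤ (suc k) x y
  dist≤-step {k} {x} {y} xz zy = ∨-introʳ (any-allFin⁺ (λ z → within G k x z ∧ adj G z y) (∧-intro xz zy))

  dist≤-suc⁻ : ∀ {k x y} → Dist≤ (suc k) x y → Dist≤ k x y ⊎ ∃ λ z → Dist≤ k x z × z ~ y
  dist≤-suc⁻ {k} {x} {y} h with ∨-elim h
  ... | inj₁ xy = inj₁ xy
  ... | inj₂ path with any-allFin⁻ (λ z → within G k x z ∧ adj G z y) path
  ...   | z , xzy = inj₂ (z , ∧-elimˡ xzy , ∧-elimʳ {within G k x z} xzy)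

  dist≤1-refl : ∀ {x} → Dist≤ 1 x x
  dist≤1-refl {x} = dist≤-weaken {0} {x} {x} dist≤0-refl

  dist≤1⇒2 : ∀ {x y} → Dist≤ 1 x y → Dist≤ 2 x y
  dist≤1⇒2 {x} {y} = dist≤-weaken {1} {x} {y}

  dist≤1-adj : ∀ {x y} → x ~ y → Dist≤ 1 x y
  dist≤1-adj {x} = dist≤-step {0} {x} dist≤0-refl

  dist≤1⁻ : ∀ {x y} → Dist≤ 1 x y → x ≡ y ⊎ x ~ y
  dist≤1⁻ {x} {y} h with dist≤-suc⁻ {0} {x} {y} h
  ... | inj₁ x≡y = inj₁ (x∈⁅y⁆⇒x≡y x≡y)
  ... | inj₂ (z , x≡z , zy) = inj₂ (subst (_~ y) (sym (x∈⁅y⁆⇒x≡y x≡z)) zy)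

  dist≤2-path : ∀ {x y z} → x ~ z → z ~ y → Dist≤ 2 x y
  dist≤2-path {x} {y} {z} xz zy = dist≤-step {1} {x} {y} {z} (dist≤1-adj xz) zy

  dist≤2⁻ : ∀ {x y} → Dist≤ 2 x y → Dist≤ 1 x y ⊎ ∃ λ z → x ~ z × z ~ y
  dist≤2⁻ {x} {y} h with dist≤-suc⁻ {1} {x} {y} h
  ... | inj₁ xy = inj₁ xy
  ... | inj₂ (z , xz , zy) with dist≤1⁻ {x} {z} xz
  ...   | inj₁ refl = inj₁ (dist≤1-adj zy)
  ...   | inj₂ x~z = inj₂ (z , x~z , zy)

  dist≤1-sym : ∀ {x y} → Dist≤ 1 x y → Dist≤ 1 y x
  dist≤1-sym h with dist≤1⁻ h
  ... | inj₁ refl = dist≤1-refl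
  ... | inj₂ xy = dist≤1-adj (~-sym xy)

  dist≤2-sym : ∀ {x y} → Dist≤ 2 x y → Dist≤ 2 y x
  dist≤2-sym h with dist≤2⁻ h
  ... | inj₁ xy = dist≤1⇒2 (dist≤1-sym xy)
  ... | inj₂ (z , xz , zy) = dist≤2-path (~-sym zy) (~-sym xz)

  ∣N[x]∣≡1+∣adj∣ : ∀ x → ∣ N[ x ] ∣ ≡ suc ∣ adj G x ∣
  ∣N[x]∣≡1+∣adj∣ x = trans (∣∣-split N[ x ] ⁅ x ⁆)
    (cong₂ _+_ (trans (∣∣-cong (λ _ → ∧-elimʳ) ⁅x⁆⊆N[x]∩⁅x⁆) (∣⁅x⁆∣≡1 x))
               (∣∣-cong N[x]∖⁅x⁆⊆adj adj⊆N[x]∖⁅x⁆))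
    where
    ⁅x⁆⊆N[x]∩⁅x⁆ : ⁅ x ⁆ ⊆ N[ x ] ∩ ⁅ x ⁆
    ⁅x⁆⊆N[x]∩⁅x⁆ y y∈⁅x⁆ = ∧-intro (subst (Dist≤ 1 x) (sym (x∈⁅y⁆⇒x≡y y∈⁅x⁆)) dist≤1-refl) y∈⁅x⁆
    N[x]∖⁅x⁆⊆adj : N[ x ] ∖ ⁅ x ⁆ ⊆ adj G x
    N[x]∖⁅x⁆⊆adj y h with dist≤1⁻ {x} {y} (∧-elimˡ h)
    ... | inj₁ refl = ⊥-elim (not-elim (∧-elimʳ {N[ x ] x} h) (x≡y⇒x∈⁅y⁆ refl))
    ... | inj₂ xy = xy
    adj⊆N[x]∖⁅x⁆ : adj G x ⊆ N[ x ] ∖ ⁅ x ⁆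
    adj⊆N[x]∖⁅x⁆ y xy = ∧-intro (dist≤1-adj xy)
                                 (not-intro λ y∈⁅x⁆ → ~-irrefl (subst (x ~_) (x∈⁅y⁆⇒x≡y y∈⁅x⁆) xy))

chain-end : ∀ {G : Graph n} {x y} → Chain G x y → InX G y
chain-end (start x∈X) = x∈X
chain-end (step _ y∈X _) = y∈X

-- The ball of radius 2 around v

module Ball {n : ℕ} (G : Graph n) {d : ℕ} (7≤d : 7 ≤ d) (regular : Regular G d)
            (v u : Fin n) (deg₂v≡2 : deg₂ G v ≡ 2) (N₂'v≡u : ∀ w → T (N₂' G v w) ⇔ w ≡ u) where

  open Distance G

  B A : Fin n → Bool
  B = within G 2 v
  A = adj G v

  N₂ : Fin n → Fin n → Bool
  N₂ = Nbhd G 2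

  Gᵥ : Fin n → Set
  Gᵥ y = T (B y) × y ≢ u

  t : ℕ
  t = ∣ adj G u ∖ B ∣

  ∣adj∣≡d : ∀ x → ∣ adj G x ∣ ≡ d
  ∣adj∣≡d x = trans (sym (count≡∣∣ G (adj G x))) (regular x)

  ∣N[x]∣≡1+d : ∀ x → ∣ N[ x ] ∣ ≡ suc d
  ∣N[x]∣≡1+d x = trans (∣N[x]∣≡1+∣adj∣ x) (cong suc (∣adj∣≡d x))

  u∈N₂'v : T (N₂' G v u)
  u∈N₂'v = Equivalence.from (N₂'v≡u u) refl

  u∈B : T (B u)
  u∈B = ∧-elimˡ (∧-elimˡ u∈N₂'v)

  u∉N[v] : ¬ T (N[ v ] u)
  u∉N[v] = not-elim (∧-elimʳ {B u} (∧-elimˡ u∈N₂'v))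

  v≢u : v ≢ u
  v≢u refl = u∉N[v] dist≤1-refl

  v∈Gᵥ : Gᵥ v
  v∈Gᵥ = dist≤1⇒2 dist≤1-refl , v≢u

  A⊆B : A ⊆ B
  A⊆B y vy = dist≤1⇒2 (dist≤1-adj vy)

  u-leaves-B : ∃ λ x → u ~ x × ¬ T (B x)
  u-leaves-B with any-allFin⁻ (λ z → Nbhd G 3 v z ∧ adj G u z) (∧-elimʳ {N₂ v u} u∈N₂'v)
  ... | x , h = x , ∧-elimʳ {Nbhd G 3 v x} h , not-elim (∧-elimʳ {within G 3 v x} (∧-elimˡ h))

  -- A vertex of N₂(v) with a neighbour outside B lies in N₂'(v) = {u}.
  ball-closed : ∀ {y w} → Gᵥ y → y ~ w → T (B w)
  ball-closed {y} {w} (y∈B , y≢u) yw with T-dec (N[ v ] y) | T-dec (B w)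
  ... | inj₁ near | _ = dist≤-step {1} {v} {w} {y} near yw
  ... | inj₂ _ | inj₁ w∈B = w∈B
  ... | inj₂ far | inj₂ w∉B = ⊥-elim (y≢u (Equivalence.to (N₂'v≡u y) y∈N₂'v))
    where
    y∈N₂'v : T (N₂' G v y)
    y∈N₂'v = ∧-intro (∧-intro y∈B (not-intro far))
      (any-allFin⁺ (λ z → Nbhd G 3 v z ∧ adj G y z)
                   (∧-intro (∧-intro (dist≤-step {2} {v} {w} {y} y∈B yw) (not-intro w∉B)) yw))

  Gᵥ-N[y]⊆B : ∀ {y} → Gᵥ y → N[ y ] ⊆ B
  Gᵥ-N[y]⊆B {y} g w yw with dist≤1⁻ {y} {w} yw
  ... | inj₁ refl = proj₁ g
  ... | inj₂ y~w = ball-closed g y~w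

  ∣B∣≡d+3 : ∣ B ∣ ≡ suc d + 2
  ∣B∣≡d+3 = begin
    ∣ B ∣                   ≡⟨ ∣∣-⊆ (Gᵥ-N[y]⊆B v∈Gᵥ) ⟨
    ∣ N[ v ] ∣ + ∣ N₂ v ∣     ≡⟨ cong₂ _+_ (∣N[x]∣≡1+d v) (trans (sym (count≡∣∣ G (N₂ v))) deg₂v≡2) ⟩
    suc d + 2               ∎
    where open ≡-Reasoning

  ∣B∖N[y]∣≡2 : ∀ {y} → Gᵥ y → ∣ B ∖ N[ y ] ∣ ≡ 2
  ∣B∖N[y]∣≡2 {y} g = +-cancelˡ-≡ (suc d) _ _ (begin
    suc d + ∣ B ∖ N[ y ] ∣       ≡⟨ cong (_+ ∣ B ∖ N[ y ] ∣) (∣N[x]∣≡1+d y) ⟨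
    ∣ N[ y ] ∣ + ∣ B ∖ N[ y ] ∣   ≡⟨ ∣∣-⊆ (Gᵥ-N[y]⊆B g) ⟩
    ∣ B ∣                       ≡⟨ ∣B∣≡d+3 ⟩
    suc d + 2                   ∎)
    where open ≡-Reasoning

  ∣B∖A∣≡3 : ∣ B ∖ A ∣ ≡ 3
  ∣B∖A∣≡3 = +-cancelˡ-≡ d _ _ (begin
    d + ∣ B ∖ A ∣       ≡⟨ cong (_+ ∣ B ∖ A ∣) (∣adj∣≡d v) ⟨
    ∣ A ∣ + ∣ B ∖ A ∣   ≡⟨ ∣∣-⊆ A⊆B ⟩
    ∣ B ∣              ≡⟨ trans ∣B∣≡d+3 (sym (+-suc d 2)) ⟩
    d + 3              ∎)
    where open ≡-Reasoning

  d≤∣adj∩A∣+3 : ∀ {y} → Gᵥ y → d ≤ ∣ adj G y ∩ A ∣ + 3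
  d≤∣adj∩A∣+3 {y} g = begin
    d                                  ≡⟨ ∣adj∣≡d y ⟨
    ∣ adj G y ∣                         ≤⟨ ∣∣-mono cover ⟩
    ∣ adj G y ∩ A ∪ B ∖ A ∣              ≤⟨ ∣∣-∪ (adj G y ∩ A) (B ∖ A) ⟩
    ∣ adj G y ∩ A ∣ + ∣ B ∖ A ∣          ≡⟨ cong (∣ adj G y ∩ A ∣ +_) ∣B∖A∣≡3 ⟩
    ∣ adj G y ∩ A ∣ + 3                 ∎
    where
    open ≤-Reasoning
    cover : adj G y ⊆ adj G y ∩ A ∪ B ∖ A
    cover w yw with T-dec (A w)
    ... | inj₁ w∈A = ∨-introˡ (∧-intro yw w∈A)
    ... | inj₂ w∉A = ∨-introʳ (∧-intro (ball-closed g yw) (not-intro w∉A))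

  common-neighbour : ∀ {y w} → Gᵥ y → Gᵥ w → ∃ λ z → v ~ z × y ~ z × w ~ z
  common-neighbour {y} {w} gy gw =
    let z , yz , wz = ∣∣-overlap {p = adj G y ∩ A} {adj G w ∩ A} {A}
                        (λ _ → ∧-elimʳ {adj G y _}) (λ _ → ∧-elimʳ {adj G w _})
                        (subst (_< ∣ adj G y ∩ A ∣ + ∣ adj G w ∩ A ∣) (sym (∣adj∣≡d v))
                               (d<a+b (d≤∣adj∩A∣+3 gy) (d≤∣adj∩A∣+3 gw)))
    in z , ∧-elimʳ {adj G y z} yz , ∧-elimˡ yz , ∧-elimˡ wz
    where
    d<a+b : ∀ {a b} → d ≤ a + 3 → d ≤ b + 3 → d < a + b
    d<a+b {a} {b} d≤a+3 d≤b+3 = +-cancelʳ-≤ 6 (suc d) (a + b) (begin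
      suc d + 6          ≡⟨ +-comm (suc d) 6 ⟩
      7 + d              ≤⟨ +-monoˡ-≤ d 7≤d ⟩
      d + d              ≤⟨ +-mono-≤ d≤a+3 d≤b+3 ⟩
      a + 3 + (b + 3)    ≡⟨ regroup a b ⟩
      a + b + 6          ∎)
      where
      open ≤-Reasoning
      regroup : ∀ a b → a + 3 + (b + 3) ≡ a + b + 6
      regroup = solve-∀

  Gᵥ-dist≤2 : ∀ {y w} → Gᵥ y → Gᵥ w → Dist≤ 2 y w
  Gᵥ-dist≤2 gy gw = let _ , _ , yz , wz = common-neighbour gy gw in dist≤2-path yz (~-sym wz)

  0<t : 0 < t
  0<t with u-leaves-B
  ... | x , ux , x∉B = ∣∣-positive (adj G u ∖ B) (∧-intro ux (not-intro x∉B))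

  open DegreeSum G ∣adj∣≡d B using (adjFrom; edgesOut; 2∣edgesOut)

  edgesOut≡t : edgesOut ≡ t
  edgesOut≡t = begin
    ∑[ x < n ] ∣ adjFrom x ∖ B ∣          ≡⟨ sum-cong-≗ leaving ⟩
    ∑[ x < n ] (ind (⁅ u ⁆ x) * t)       ≡⟨ *-distribʳ-sum t (ind ∘ ⁅ u ⁆) ⟨
    ∑[ x < n ] ind (⁅ u ⁆ x) * t         ≡⟨ cong (_* t) (trans (sym (∣∣-as-∑ ⁅ u ⁆)) (∣⁅x⁆∣≡1 u)) ⟩
    1 * t                               ≡⟨ *-identityˡ t ⟩
    t                                   ∎
    where
    open ≡-Reasoning
    leaving : ∀ x → ∣ adjFrom x ∖ B ∣ ≡ ind (⁅ u ⁆ x) * t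
    leaving x with x ≟ u
    ... | yes refl = trans (∣∣-cong (λ y h → ∧-intro (∧-elimʳ {B u} (∧-elimˡ h)) (∧-elimʳ {B u ∧ adj G u y} h))
                                    (λ y h → ∧-intro (∧-intro u∈B (∧-elimˡ h)) (∧-elimʳ {adj G u y} h)))
                           (sym (+-identityʳ t))
    ... | no x≢u = ∣∣-empty (adjFrom x ∖ B) λ y h →
            not-elim (∧-elimʳ {adjFrom x y} h) (ball-closed (∧-elimˡ (∧-elimˡ h) , x≢u) (∧-elimʳ {B x} (∧-elimˡ h)))

  2≤t : 2 ≤ t
  2≤t = ∣⇒≤ {{>-nonZero 0<t}}
    (subst (2 ∣_) edgesOut≡t (2∣edgesOut (subst (λ m → 2 ∣ m * d) (sym ∣B∣≡d+3) (2∣[d+3]*d d))))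

  ∣N[u]∩B∣+t≡1+d : ∣ N[ u ] ∩ B ∣ + t ≡ suc d
  ∣N[u]∩B∣+t≡1+d = begin
    ∣ N[ u ] ∩ B ∣ + t                ≡⟨ cong (∣ N[ u ] ∩ B ∣ +_) (∣∣-cong adj∖B⊆N[u]∖B N[u]∖B⊆adj∖B) ⟩
    ∣ N[ u ] ∩ B ∣ + ∣ N[ u ] ∖ B ∣    ≡⟨ ∣∣-split N[ u ] B ⟨
    ∣ N[ u ] ∣                        ≡⟨ ∣N[x]∣≡1+d u ⟩
    suc d                            ∎
    where
    open ≡-Reasoning
    N[u]∖B⊆adj∖B : N[ u ] ∖ B ⊆ adj G u ∖ B
    N[u]∖B⊆adj∖B y h with dist≤1⁻ {u} {y} (∧-elimˡ h)
    ... | inj₁ refl = ⊥-elim (not-elim (∧-elimʳ {N[ u ] u} h) u∈B)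
    ... | inj₂ uy = ∧-intro uy (∧-elimʳ {N[ u ] y} h)
    adj∖B⊆N[u]∖B : adj G u ∖ B ⊆ N[ u ] ∖ B
    adj∖B⊆N[u]∖B y h = ∧-intro (dist≤1-adj (∧-elimˡ h)) (∧-elimʳ {adj G u y} h)

  t≤1+∣adj∖N[u]∣ : ∀ {y} → Gᵥ y → t ≤ suc ∣ adj G y ∖ N[ u ] ∣
  t≤1+∣adj∖N[u]∣ {y} g = +-cancelˡ-≤ d t (suc k) (begin
    d + t             ≤⟨ +-monoˡ-≤ t d≤k+c ⟩
    k + c + t         ≡⟨ +-assoc k c t ⟩
    k + (c + t)       ≡⟨ cong (k +_) ∣N[u]∩B∣+t≡1+d ⟩
    k + suc d         ≡⟨ +-suc k d ⟩
    suc k + d         ≡⟨ +-comm (suc k) d ⟩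
    d + suc k         ∎)
    where
    open ≤-Reasoning
    k c : ℕ
    k = ∣ adj G y ∖ N[ u ] ∣
    c = ∣ N[ u ] ∩ B ∣
    cover : adj G y ⊆ adj G y ∖ N[ u ] ∪ N[ u ] ∩ B
    cover w yw with T-dec (N[ u ] w)
    ... | inj₁ near = ∨-introʳ (∧-intro near (ball-closed g yw))
    ... | inj₂ far = ∨-introˡ (∧-intro yw (not-intro far))
    d≤k+c : d ≤ k + c
    d≤k+c = ≤-trans (≤-reflexive (sym (∣adj∣≡d y)))
                    (≤-trans (∣∣-mono cover) (∣∣-∪ (adj G y ∖ N[ u ]) (N[ u ] ∩ B)))

  Gᵥ-good-neighbour : ∀ {y} → Gᵥ y → ∃ λ z → y ~ z × Gᵥ z × ¬ z ~ u
  Gᵥ-good-neighbour {y} g with ∣∣-nonempty (adj G y ∖ N[ u ]) (s≤s⁻¹ (≤-trans 2≤t (t≤1+∣adj∖N[u]∣ g)))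
  ... | z , h = z , yz , (ball-closed g yz , z≢u) , λ zu → z∉N[u] (dist≤1-adj (~-sym zu))
    where
    yz : y ~ z
    yz = ∧-elimˡ h
    z∉N[u] : ¬ T (N[ u ] z)
    z∉N[u] = not-elim (∧-elimʳ {adj G y z} h)
    z≢u : z ≢ u
    z≢u refl = z∉N[u] dist≤1-refl

  Gᵥ-deg₂≤2 : ∀ {y} → Gᵥ y → ¬ y ~ u → ∣ N₂ y ∣ ≤ 2
  Gᵥ-deg₂≤2 {y} g y≁u = subst (∣ N₂ y ∣ ≤_) (∣B∖N[y]∣≡2 g) (∣∣-mono N₂y⊆B∖N[y])
    where
    N₂y⊆B∖N[y] : N₂ y ⊆ B ∖ N[ y ]
    N₂y⊆B∖N[y] w h with dist≤2⁻ {y} {w} (∧-elimˡ h)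
    ... | inj₁ near = ⊥-elim (not-elim (∧-elimʳ {within G 2 y w} h) near)
    ... | inj₂ (z , yz , zw) = ∧-intro (ball-closed (ball-closed g yz , λ { refl → y≁u yz }) zw) (∧-elimʳ {within G 2 y w} h)

  Gᵥ-deg₂≥4 : ∀ {y} → Gᵥ y → y ~ u → 4 ≤ ∣ N₂ y ∣
  Gᵥ-deg₂≥4 {y} g yu = begin
    4                              ≤⟨ +-monoʳ-≤ 2 2≤t ⟩
    2 + t                          ≡⟨ cong (_+ t) (∣B∖N[y]∣≡2 g) ⟨
    ∣ B ∖ N[ y ] ∣ + t              ≤⟨ +-mono-≤ (∣∣-mono inside) (∣∣-mono outside) ⟩
    ∣ N₂ y ∩ B ∣ + ∣ N₂ y ∖ B ∣      ≡⟨ ∣∣-split (N₂ y) B ⟨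
    ∣ N₂ y ∣                        ∎
    where
    open ≤-Reasoning
    inside : B ∖ N[ y ] ⊆ N₂ y ∩ B
    inside w h = ∧-intro (∧-intro (Gᵥ-dist≤2 g (w∈B , w≢u)) (∧-elimʳ {B w} h)) w∈B
      where
      w∈B : T (B w)
      w∈B = ∧-elimˡ h
      w≢u : w ≢ u
      w≢u refl = not-elim (∧-elimʳ {B u} h) (dist≤1-adj yu)
    outside : adj G u ∖ B ⊆ N₂ y ∖ B
    outside w h = ∧-intro (∧-intro (dist≤2-path yu (∧-elimˡ h))
                                   (not-intro λ near → not-elim w∉B (Gᵥ-N[y]⊆B g w near))) w∉B
      where
      w∉B : T (not (B w))
      w∉B = ∧-elimʳ {adj G u w} h

  t≤1+∣N₂u∣ : t ≤ suc ∣ N₂ u ∣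
  t≤1+∣N₂u∣ with dist≤2⁻ {v} {u} u∈B
  ... | inj₁ near = ⊥-elim (u∉N[v] near)
  ... | inj₂ (a , va , au) = ≤-trans (t≤1+∣adj∖N[u]∣ a∈Gᵥ) (s≤s (∣∣-mono adj∖N[u]⊆N₂))
    where
    a∈Gᵥ : Gᵥ a
    a∈Gᵥ = A⊆B a va , λ { refl → u∉N[v] (dist≤1-adj va) }
    adj∖N[u]⊆N₂ : adj G a ∖ N[ u ] ⊆ N₂ u
    adj∖N[u]⊆N₂ w h = ∧-intro (dist≤2-path (~-sym au) (∧-elimˡ h)) (∧-elimʳ {adj G a w} h)

  1+d≤∣N₂u∣+t : suc d ≤ ∣ N₂ u ∣ + t
  1+d≤∣N₂u∣+t with u-leaves-B
  ... | x , ux , x∉B = begin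
    suc d                                ≡⟨ ∣N[x]∣≡1+d x ⟨
    ∣ N[ x ] ∣                            ≤⟨ ∣∣-mono cover ⟩
    ∣ ⁅ u ⁆ ∪ N₂ u ∖ B ∪ adj G u ∖ B ∣     ≤⟨ ∣∣-∪ (⁅ u ⁆ ∪ N₂ u ∖ B) (adj G u ∖ B) ⟩
    ∣ ⁅ u ⁆ ∪ N₂ u ∖ B ∣ + t               ≤⟨ +-monoˡ-≤ t (∣∣-∪ ⁅ u ⁆ (N₂ u ∖ B)) ⟩
    ∣ ⁅ u ⁆ ∣ + ∣ N₂ u ∖ B ∣ + t            ≡⟨ cong (λ m → m + ∣ N₂ u ∖ B ∣ + t) (∣⁅x⁆∣≡1 u) ⟩
    suc ∣ N₂ u ∖ B ∣ + t                  ≤⟨ +-monoˡ-≤ t 1+∣N₂u∖B∣≤∣N₂u∣ ⟩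
    ∣ N₂ u ∣ + t                          ∎
    where
    open ≤-Reasoning
    v∈N₂u∩B : T ((N₂ u ∩ B) v)
    v∈N₂u∩B = ∧-intro (∧-intro (dist≤2-sym u∈B) (not-intro (u∉N[v] ∘ dist≤1-sym))) (proj₁ v∈Gᵥ)
    1+∣N₂u∖B∣≤∣N₂u∣ : suc ∣ N₂ u ∖ B ∣ ≤ ∣ N₂ u ∣
    1+∣N₂u∖B∣≤∣N₂u∣ = subst (suc ∣ N₂ u ∖ B ∣ ≤_) (sym (∣∣-split (N₂ u) B))
                             (+-monoˡ-≤ ∣ N₂ u ∖ B ∣ (∣∣-positive (N₂ u ∩ B) v∈N₂u∩B))
    beyond : ∀ {y} → T (N[ x ] y) → y ≢ u → Dist≤ 2 u y × ¬ T (B y)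
    beyond {y} xy y≢u with dist≤1⁻ {x} {y} xy
    ... | inj₁ refl = dist≤1⇒2 (dist≤1-adj ux) , x∉B
    ... | inj₂ x~y = dist≤2-path ux x~y , λ y∈B → x∉B (ball-closed (y∈B , y≢u) (~-sym x~y))
    cover : N[ x ] ⊆ ⁅ u ⁆ ∪ N₂ u ∖ B ∪ adj G u ∖ B
    cover y xy with y ≟ u
    ... | yes _ = tt
    ... | no y≢u with beyond xy y≢u | dist≤1⁻ {u} {y} | T-dec (N[ u ] y)
    ...   | u2y , y∉B | _ | inj₂ far = ∨-introˡ (∧-intro (∧-intro u2y (not-intro far)) (not-intro y∉B))
    ...   | _ , y∉B | near⁻ | inj₁ near with near⁻ near
    ...     | inj₁ refl = ⊥-elim (y≢u refl)
    ...     | inj₂ uy = ∨-introʳ (∧-intro uy (not-intro y∉B))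

  4≤∣N₂u∣ : 4 ≤ ∣ N₂ u ∣
  4≤∣N₂u∣ with 4 ≤? ∣ N₂ u ∣
  ... | yes 4≤m = 4≤m
  ... | no 4≰m = ⊥-elim (<-irrefl refl 7<7)
    where
    open ≤-Reasoning
    m : ℕ
    m = ∣ N₂ u ∣
    m≤3 : m ≤ 3
    m≤3 = s≤s⁻¹ (≰⇒> 4≰m)
    7<7 : 7 < 7
    7<7 = begin-strict
      7                 ≤⟨ 7≤d ⟩
      d                 <⟨ 1+d≤∣N₂u∣+t ⟩
      m + t             ≤⟨ +-monoʳ-≤ m t≤1+∣N₂u∣ ⟩
      m + suc m         ≡⟨ +-suc m m ⟩
      suc (m + m)       ≤⟨ s≤s (+-mono-≤ m≤3 m≤3) ⟩
      7                 ∎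

  InX⇒∣N₂∣<4 : ∀ {y} → InX G y → ∣ N₂ y ∣ < 4
  InX⇒∣N₂∣<4 {y} = subst (_< 4) (count≡∣∣ G (N₂ y))

  Gᵥ-InX : ∀ {y} → Gᵥ y → ¬ y ~ u → InX G y
  Gᵥ-InX {y} g y≁u = subst (_< 4) (sym (count≡∣∣ G (N₂ y))) (s≤s (≤-trans (Gᵥ-deg₂≤2 g y≁u) (n≤1+n 2)))

  Gᵥ-InX⇒≁u : ∀ {y} → Gᵥ y → InX G y → ¬ y ~ u
  Gᵥ-InX⇒≁u {y} g y∈X yu = <⇒≱ (InX⇒∣N₂∣<4 {y} y∈X) (Gᵥ-deg₂≥4 g yu)

  u∉X : ¬ InX G u
  u∉X u∈X = <⇒≱ (InX⇒∣N₂∣<4 {u} u∈X) 4≤∣N₂u∣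

  Gᵥ-step : ∀ {y z} → Gᵥ y → InX G y → InX G z → Dist≤ 2 y z → Gᵥ z
  Gᵥ-step {y} {z} g y∈X z∈X yz with dist≤2⁻ {y} {z} yz
  ... | inj₁ near = Gᵥ-N[y]⊆B g z near , z≢u
    where
    z≢u : z ≢ u
    z≢u refl = u∉X z∈X
  ... | inj₂ (m , ym , mz) = ball-closed (ball-closed g ym , λ { refl → Gᵥ-InX⇒≁u g y∈X ym }) mz , z≢u
    where
    z≢u : z ≢ u
    z≢u refl = u∉X z∈X

  chain-Gᵥ : ∀ {x₀ y} → Chain G x₀ y → Gᵥ x₀ → Gᵥ y
  chain-Gᵥ (start _) g = g
  chain-Gᵥ (step c z∈X yz) g = Gᵥ-step (chain-Gᵥ c g) (chain-end c) z∈X yz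

  chain-Gᵥ⁻ : ∀ {x₀ y} → Chain G x₀ y → Gᵥ y → Gᵥ x₀
  chain-Gᵥ⁻ (start _) g = g
  chain-Gᵥ⁻ (step c z∈X yz) g = chain-Gᵥ⁻ c (Gᵥ-step g z∈X (chain-end c) (dist≤2-sym yz))

  region⇒chain : ∀ {x₀} → Region G x₀ v → Chain G x₀ v
  region⇒chain (inj₁ x₀⇝v) = x₀⇝v
  region⇒chain (inj₂ (z , x₀⇝z , zv)) = step x₀⇝z v∈X (dist≤1⇒2 (dist≤1-adj zv))
    where
    v∈X : InX G v
    v∈X = subst (_< 4) (sym deg₂v≡2) (s≤s (s≤s (s≤s z≤n)))

  region⊆Gᵥ : ∀ {x₀ y} → Chain G x₀ v → Region G x₀ y → Gᵥ y
  region⊆Gᵥ x₀⇝v (inj₁ x₀⇝y) = chain-Gᵥ x₀⇝y (chain-Gᵥ⁻ x₀⇝v v∈Gᵥ)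
  region⊆Gᵥ x₀⇝v (inj₂ (z , x₀⇝z , zy)) =
    ball-closed z∈Gᵥ zy , λ { refl → Gᵥ-InX⇒≁u z∈Gᵥ (chain-end x₀⇝z) zy }
    where
    z∈Gᵥ : Gᵥ z
    z∈Gᵥ = chain-Gᵥ x₀⇝z (chain-Gᵥ⁻ x₀⇝v v∈Gᵥ)

  Gᵥ⊆region : ∀ {x₀ y} → Chain G x₀ v → Gᵥ y → Region G x₀ y
  Gᵥ⊆region x₀⇝v gy =
    let z , yz , gz , z≁u = Gᵥ-good-neighbour gy
    in inj₂ (z , step x₀⇝v (Gᵥ-InX gz z≁u) (Gᵥ-dist≤2 v∈Gᵥ gz) , ~-sym yz)

  component⊆Gᵥ : ∀ {y} → CompAvoid G u v y → Gᵥ y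
  component⊆Gᵥ (here _) = v∈Gᵥ
  component⊆Gᵥ (there c yz z≢u) = ball-closed (component⊆Gᵥ c) yz , z≢u

  Gᵥ⊆component : ∀ {y} → Gᵥ y → CompAvoid G u v y
  Gᵥ⊆component g@(_ , y≢u) =
    let z , vz , _ , yz = common-neighbour v∈Gᵥ g
    in there (there (here v≢u) vz λ z≡u → u∉N[v] (dist≤1-adj (subst (v ~_) z≡u vz))) (~-sym yz) y≢u

lemma4p5 : ∀ {n} (d : ℕ) → 6 < d → (G : Graph n) → Regular G d → SquareNotComplete G →
    (x₀ : Fin n) → InX G x₀ → IsCRegion G (Region G x₀) →
    (v u : Fin n) → Region G x₀ v → deg₂ G v ≡ 2 →
    (∀ w → T (N₂' G v w) ⇔ w ≡ u) →
    ∀ y → Region G x₀ y ⇔ CompAvoid G u v y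
lemma4p5 d 6<d G regular _ x₀ _ _ v u v∈R deg₂v≡2 N₂'v≡u y =
  mk⇔ (Gᵥ⊆component ∘ region⊆Gᵥ x₀⇝v) (Gᵥ⊆region x₀⇝v ∘ component⊆Gᵥ)
  where
  open Ball G 6<d regular v u deg₂v≡2 N₂'v≡u
  x₀⇝v : Chain G x₀ v
  x₀⇝v = region⇒chain v∈R
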